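{- Let $G=(V,E)$ be a finite simple graph without isolated vertices, and let $V_p,V_b\subseteq V$ be disjoint sets (the purple and blue vertices). Suppose that no vertex $v\in V$ satisfies $N[v]\subseteq V_p$ or $N[v]\subseteq V_b$, and that $V_p$ and $V_b$ are not both dominating sets of $G$. Then there exist a vertex $u\notin V_p\cup V_b$ and a color $c\in\{p,b\}$ such that coloring $u$ with $c$ is a legal move, i.e. some $w\in N[u]$ satisfies $N[w]\cap V_c=\emptyset$.
   Context: $N[v]$ denotes the closed neighborhood of $v$. A set $D\subseteq V$ is dominating if every vertex of $V$ is in $D$ or adjacent to a vertex of $D$. -}

module Defs where

open import Data.Nat using (ℕ)
open import Data.Fin using (Fin)
open import Data.Fin.Subset using (Subset; _∈_; _∉_)
open import Data.Product using (∃; _×_)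
open import Data.Sum using (_⊎_)
open import Relation.Nullary using (¬_; Dec)
open import Relation.Binary.PropositionalEquality using (_≡_)
open import Level using (0ℓ; suc)

record SimpleGraph (n : ℕ) : Set₁ where
  field
    Adj     : Fin n → Fin n → Set
    adj?    : ∀ u v → Dec (Adj u v)
    sym     : ∀ {u v} → Adj u v → Adj v u
    irrefl  : ∀ {v} → ¬ Adj v v

module _ {n : ℕ} (G : SimpleGraph n) where
  open SimpleGraph G

  InN[_] : Fin n → Fin n → Set
  InN[ v ] u = u ≡ v ⊎ Adj v u

  NoIsolated : Set
  NoIsolated = ∀ v → ∃ λ u → Adj v u

  ClosedNbhdSubset : Fin n → Subset n → Set
  ClosedNbhdSubset v S = ∀ u → InN[ v ] u → u ∈ S

  ClosedNbhdDisjoint : Fin n → Subset n → Set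
  ClosedNbhdDisjoint v S = ∀ u → InN[ v ] u → u ∉ S

  Dominating : Subset n → Set
  Dominating D = ∀ v → v ∈ D ⊎ ∃ λ u → u ∈ D × Adj v u

Disjoint : {n : ℕ} → Subset n → Subset n → Set
Disjoint A B = ∀ v → v ∈ A → v ∉ B

-- If Vp is not dominating, some w has N[w] ∩ Vp = ∅; since N[w] ⊈ Vb, some u ∈ N[w]
-- lies outside Vb, and outside Vp because N[w] misses Vp. Then w ∈ N[u], so colouring
-- u purple is legal. If Vp is dominating, Vb is not, and the roles of the colours swap.
module Submission where

open import Defs
open import Data.Nat using (ℕ)
open import Data.Fin using (Fin; _≟_)
open import Data.Fin.Subset using (Subset; _∈_; _∉_)
open import Data.Fin.Subset.Properties using (_∈?_)
open import Data.Fin.Properties using (any?; all?; ¬∀⟶∃¬)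
open import Data.Empty using (⊥-elim)
open import Data.Product using (∃; _×_; _,_; proj₁; proj₂)
open import Data.Sum using (_⊎_; inj₁; inj₂)
open import Relation.Nullary using (¬_; Dec; yes; no)
open import Relation.Nullary.Decidable using (_×-dec_; _⊎-dec_; _→-dec_; decidable-stable)
open import Relation.Binary.PropositionalEquality using (refl; sym)

¬→⇒×¬ : {A B : Set} → Dec A → ¬ (A → B) → A × ¬ B
¬→⇒×¬ a? ¬a→b =
  decidable-stable a? (λ ¬a → ¬a→b (λ a → ⊥-elim (¬a a))) , λ b → ¬a→b (λ _ → b)

module _ {n : ℕ} (G : SimpleGraph n) where
  open SimpleGraph G renaming (sym to Adj-sym)

  InN? : ∀ v u → Dec (InN[_] G v u)
  InN? v u = (u ≟ v) ⊎-dec adj? v u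

  InN-sym : ∀ {v u} → InN[_] G v u → InN[_] G u v
  InN-sym (inj₁ u≡v) = inj₁ (sym u≡v)
  InN-sym (inj₂ vu)  = inj₂ (Adj-sym vu)

  dominated? : (D : Subset n) (v : Fin n) → Dec (v ∈ D ⊎ ∃ λ u → u ∈ D × Adj v u)
  dominated? D v = (v ∈? D) ⊎-dec any? (λ u → (u ∈? D) ×-dec adj? v u)

  Dominating? : (D : Subset n) → Dec (Dominating G D)
  Dominating? D = all? (dominated? D)

  ¬Dominating⇒∃ClosedNbhdDisjoint : ∀ {D} → ¬ Dominating G D →
    ∃ λ w → ClosedNbhdDisjoint G w D
  ¬Dominating⇒∃ClosedNbhdDisjoint {D} ¬dom with ¬∀⟶∃¬ n _ (dominated? D) ¬dom
  ... | w , ¬dominated = w , disjoint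
    where
    disjoint : ClosedNbhdDisjoint G w D
    disjoint u (inj₁ refl) u∈D = ¬dominated (inj₁ u∈D)
    disjoint u (inj₂ wu)   u∈D = ¬dominated (inj₂ (u , u∈D , wu))

  ¬ClosedNbhdSubset⇒∃∉ : ∀ {v B} → ¬ ClosedNbhdSubset G v B →
    ∃ λ u → InN[_] G v u × u ∉ B
  ¬ClosedNbhdSubset⇒∃∉ {v} {B} ¬sub
    with ¬∀⟶∃¬ n _ (λ u → InN? v u →-dec (u ∈? B)) ¬sub
  ... | u , ¬inN→∈ = u , ¬→⇒×¬ (InN? v u) ¬inN→∈

  legalMove : ∀ {D B} → ¬ Dominating G D → (∀ v → ¬ ClosedNbhdSubset G v B) →
    ∃ λ u → u ∉ D × u ∉ B × ∃ λ w → InN[_] G u w × ClosedNbhdDisjoint G w D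
  legalMove {D} {B} ¬dom ¬sub with ¬Dominating⇒∃ClosedNbhdDisjoint ¬dom
  ... | w , disjoint with ¬ClosedNbhdSubset⇒∃∉ (¬sub w)
  ...   | u , wu , u∉B = u , disjoint u wu , u∉B , w , InN-sym wu , disjoint

mainTheorem11 : {n : ℕ} (G : SimpleGraph n) (Vp Vb : Subset n) →
    NoIsolated G →
    Disjoint Vp Vb →
    (∀ v → ¬ ClosedNbhdSubset G v Vp × ¬ ClosedNbhdSubset G v Vb) →
    ¬ (Dominating G Vp × Dominating G Vb) →
    ∃ λ u → u ∉ Vp × u ∉ Vb ×
      ((∃ λ w → InN[_] G u w × ClosedNbhdDisjoint G w Vp)
       ⊎ (∃ λ w → InN[_] G u w × ClosedNbhdDisjoint G w Vb))
mainTheorem11 G Vp Vb _ _ ¬sub ¬bothDom with Dominating? G Vp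
... | no ¬domP with legalMove G ¬domP (λ v → proj₂ (¬sub v))
...   | u , u∉Vp , u∉Vb , move = u , u∉Vp , u∉Vb , inj₁ move
mainTheorem11 G Vp Vb _ _ ¬sub ¬bothDom | yes domP
  with legalMove G (λ domB → ¬bothDom (domP , domB)) (λ v → proj₁ (¬sub v))
... | u , u∉Vb , u∉Vp , move = u , u∉Vp , u∉Vb , inj₂ move
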